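{- Let $G$ be a graph and let $P=\langle p_1,\dots,p_m\rangle$ and $Q=\langle q_1,\dots,q_n\rangle$ be vertex-disjoint induced paths in $G$ such that the graph $G[V(P)\cup V(Q)]$ with the edges $p_1q_1$ and $p_mq_n$ added has treewidth at most $2$. Then for every $p_i\in V(P)$ and $q_j\in V(Q)$ with $p_iq_j\in E(G)$, the set $\{p_i,q_j\}$ separates $\{p_1,\dots,p_{i-1}\}\cup\{q_1,\dots,q_{j-1}\}$ from $\{p_{i+1},\dots,p_m\}\cup\{q_{j+1},\dots,q_n\}$ in $G[V(P)\cup V(Q)]$.
   Context: Graphs are finite, simple, undirected. A path is induced if it is an induced subgraph. A set $S$ separates vertex sets $A,B$ (disjoint from $S$ and each other) in a graph if removing $S$ leaves no path between a vertex of $A$ and a vertex of $B$. -}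

module Defs where

open import Data.Nat using (ℕ; suc; _≤_; _<_)
open import Data.Fin using (Fin; toℕ; zero; fromℕ)
open import Data.Sum using (_⊎_; inj₁; inj₂; [_,_])
open import Data.Product using (Σ; ∃; _×_; _,_)
open import Data.Empty using (⊥)
open import Data.List using (List; []; _∷_; length; _∷ʳ_)
open import Data.List.Membership.Propositional using (_∈_)
open import Data.List.Relation.Unary.All using (All)
open import Data.List.Relation.Unary.Linked using (Linked)
open import Data.List.Relation.Unary.Unique.Propositional using (Unique)
open import Relation.Binary.PropositionalEquality using (_≡_; _≢_; refl)
open import Relation.Nullary using (¬_)

record Graph (V : Set) : Set₁ where
  field
    Adj    : V → V → Set
    sym    : ∀ {u v} → Adj u v → Adj v u
    irrefl : ∀ {v} → ¬ Adj v v
open Graph public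

record IsPath {V : Set} (G : Graph V) (a b : V) (xs : List V) : Set where
  field
    distinct : Unique xs
    linked   : Linked (Adj G) xs
    starts   : Σ (List V) λ ys → xs ≡ a ∷ ys
    ends     : Σ (List V) λ ys → xs ≡ ys ∷ʳ b

record IsCycle {V : Set} (G : Graph V) (xs : List V) : Set where
  field
    distinct : Unique xs
    linked   : Linked (Adj G) xs
    long     : 3 ≤ length xs
    closes   : Σ V λ a → Σ V λ b → Σ (List V) λ ys →
               (xs ≡ a ∷ (ys ∷ʳ b)) × Adj G b a

Connected : {V : Set} → Graph V → Set
Connected {V} G = ∀ (x y : V) → ∃ λ xs → IsPath G x y xs

Acyclic : {V : Set} → Graph V → Set
Acyclic {V} G = ∀ (xs : List V) → ¬ IsCycle G xs

record IsTree {t : ℕ} (T : Graph (Fin t)) : Set where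
  field
    nonempty  : 1 ≤ t
    connected : Connected T
    acyclic   : Acyclic T

record TreeDecomposition {V : Set} (G : Graph V) (k : ℕ) : Set₁ where
  field
    t        : ℕ
    T        : Graph (Fin t)
    isTree   : IsTree T
    bag      : Fin t → List V
    bagSize  : ∀ x → length (bag x) ≤ suc k
    vertexCovered : ∀ v → ∃ λ x → v ∈ bag x
    edgeCovered   : ∀ u v → Adj G u v → ∃ λ x → (u ∈ bag x) × (v ∈ bag x)
    subtreeConnected : ∀ v x y → v ∈ bag x → v ∈ bag y →
                       ∃ λ zs → IsPath T x y zs × All (λ z → v ∈ bag z) zs

TreewidthAtMost : {V : Set} → Graph V → ℕ → Set₁
TreewidthAtMost G k = TreeDecomposition G k

Separates : {V : Set} → Graph V → (S A B : V → Set) → Set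
Separates {V} G S A B = ∀ (a b : V) (xs : List V) → A a → B b →
  IsPath G a b xs → All (λ z → ¬ S z) xs → ⊥

IsInducedPath : {N m : ℕ} → Graph (Fin N) → (Fin m → Fin N) → Set
IsInducedPath {N} {m} G p =
  (∀ i j → p i ≡ p j → i ≡ j) ×
  (∀ i j → (Adj G (p i) (p j) → (suc (toℕ i) ≡ toℕ j ⊎ suc (toℕ j) ≡ toℕ i)) ×
           ((suc (toℕ i) ≡ toℕ j ⊎ suc (toℕ j) ≡ toℕ i) → Adj G (p i) (p j)))

-- The subgraph G[V(P) ∪ V(Q)], with vertex set Fin m ⊎ Fin n
-- (inj₁ i ↦ p i, inj₂ j ↦ q j; this is a bijection onto V(P) ∪ V(Q) when P, Q are
-- injective and disjoint).
InducedPQ : {N m n : ℕ} → Graph (Fin N) → (Fin m → Fin N) → (Fin n → Fin N) →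
            Graph (Fin m ⊎ Fin n)
InducedPQ G p q = record
  { Adj = λ x y → Adj G (f x) (f y)
  ; sym = sym G
  ; irrefl = irrefl G }
  where f = [ p , q ]

-- The extra edges p₁q₁ and p_m q_n (here P = ⟨p 0 … p m⟩, Q = ⟨q 0 … q n⟩).
ExtraEdge : (m n : ℕ) → (Fin (suc m) ⊎ Fin (suc n)) → (Fin (suc m) ⊎ Fin (suc n)) → Set
ExtraEdge m n x y =
  ((x ≡ inj₁ zero) × (y ≡ inj₂ zero)) ⊎ ((x ≡ inj₂ zero) × (y ≡ inj₁ zero)) ⊎
  ((x ≡ inj₁ (fromℕ m)) × (y ≡ inj₂ (fromℕ n))) ⊎ ((x ≡ inj₂ (fromℕ n)) × (y ≡ inj₁ (fromℕ m)))

private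
  extra-sym : ∀ {m n x y} → ExtraEdge m n x y → ExtraEdge m n y x
  extra-sym (inj₁ (a , b)) = inj₂ (inj₁ (b , a))
  extra-sym (inj₂ (inj₁ (a , b))) = inj₁ (b , a)
  extra-sym (inj₂ (inj₂ (inj₁ (a , b)))) = inj₂ (inj₂ (inj₂ (b , a)))
  extra-sym (inj₂ (inj₂ (inj₂ (a , b)))) = inj₂ (inj₂ (inj₁ (b , a)))

  extra-irrefl : ∀ {m n x} → ¬ ExtraEdge m n x x
  extra-irrefl (inj₁ (refl , ()))
  extra-irrefl (inj₂ (inj₁ (refl , ())))
  extra-irrefl (inj₂ (inj₂ (inj₁ (refl , ()))))
  extra-irrefl (inj₂ (inj₂ (inj₂ (refl , ()))))

AugmentedPQ : {N m n : ℕ} → Graph (Fin N) → (Fin (suc m) → Fin N) →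
              (Fin (suc n) → Fin N) → Graph (Fin (suc m) ⊎ Fin (suc n))
AugmentedPQ {N} {m} {n} G p q = record
  { Adj = λ x y → Adj H x y ⊎ ExtraEdge m n x y
  ; sym = λ { {u} {v} (inj₁ e) → inj₁ (sym H {u} {v} e) ; (inj₂ e) → inj₂ (extra-sym e) }
  ; irrefl = λ { {v} (inj₁ e) → irrefl H {v} e ; (inj₂ e) → extra-irrefl e } }
  where H = InducedPQ G p q

SepSet : {m n : ℕ} → Fin m → Fin n → (Fin m ⊎ Fin n) → Set
SepSet i j x = (x ≡ inj₁ i) ⊎ (x ≡ inj₂ j)

Before : {m n : ℕ} → Fin m → Fin n → (Fin m ⊎ Fin n) → Set
Before i j (inj₁ i') = toℕ i' < toℕ i
Before i j (inj₂ j') = toℕ j' < toℕ j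

After : {m n : ℕ} → Fin m → Fin n → (Fin m ⊎ Fin n) → Set
After i j (inj₁ i') = toℕ i < toℕ i'
After i j (inj₂ j') = toℕ j < toℕ j'

{-# OPTIONS --safe #-}
module Submission where

-- Suppose a path from the earlier to the later vertices avoids p_i and q_j. Every vertex
-- is earlier, in the separator or later, so the path uses an edge from an earlier to a
-- later vertex. As P and Q are induced, that edge is p_x q_y with x < i and j < y (or
-- the mirror image), and together with p_i q_j it gives two crossing chords of the cycle
-- p_1 … p_m q_n … q_1 closed by the two extra edges. Cutting P before p_i and Q before q_y
-- splits the cycle into four arcs that are pairwise joined by a cycle edge or a chord: a
-- K₄ minor. A tree decomposition of width 2 has none: the bags meeting a connected vertex
-- set form a subtree, touching sets give intersecting subtrees, and pairwise intersecting
-- subtrees of a tree share a node (Helly, from uniqueness of paths in a tree), whose bag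
-- would contain four distinct vertices.

open import Defs
open import Data.Nat using (ℕ; zero; suc; _+_; _≤_; _<_; z≤n; s≤s; s≤s⁻¹)
open import Data.Nat.Properties
  using ( +-suc; suc-injective; ≤-refl; ≤-reflexive; ≤-trans; ≤-total; <-trans; <-≤-trans
        ; <-irrefl; <-asym; <⇒≱; n≤1+n; m≤n+m; m∸n+n≡m; module ≤-Reasoning )
open import Data.Fin using (Fin; zero; suc; toℕ; inject₁; fromℕ)
open import Data.Fin.Properties using (toℕ-injective; toℕ-inject₁; toℕ<n; ≤fromℕ)
import Data.Fin.Properties as Fin
open import Data.List using (List; []; _∷_; _++_; _∷ʳ_; [_]; drop; reverse; length; map)
open import Data.List.Properties using (unfold-reverse; ∷-injectiveʳ; length-++)
open import Data.List.Membership.Propositional using (_∈_)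
open import Data.List.Membership.Propositional.Properties using (∈-++⁺ˡ; ∈-++⁺ʳ; ∈-++⁻; ∈-∃++)
open import Data.List.Relation.Binary.Subset.Propositional using (_⊆_)
open import Data.List.Relation.Binary.Subset.Propositional.Properties using (∷⁺ʳ)
open import Data.List.Relation.Unary.All as All using (All; []; _∷_)
import Data.List.Relation.Unary.All.Properties as All
open import Data.List.Relation.Unary.Any using (here; there)
import Data.List.Relation.Unary.Any.Properties as Any
open import Data.List.Relation.Unary.AllPairs using ([]; _∷_)
import Data.List.Relation.Unary.First as First
open import Data.List.Relation.Unary.First.Properties using (toView)
open import Data.List.Relation.Unary.Linked using (Linked; [-]; _∷_)
open import Data.List.Relation.Unary.Unique.Propositional using (Unique)
import Data.List.Relation.Unary.Unique.Propositional.Properties as Unique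
open import Data.Product using (∃; ∃₂; _×_; _,_; proj₁; proj₂)
open import Data.Sum as Sum using (_⊎_; inj₁; inj₂; [_,_]′)
open import Data.Empty using (⊥; ⊥-elim)
open import Function using (_∘_; _on_)
open import Relation.Binary.Definitions using (DecidableEquality; Symmetric; tri<; tri≈; tri>)
open import Relation.Binary.PropositionalEquality as ≡ using (_≡_; _≢_; refl; cong; subst)
open import Relation.Nullary using (¬_; yes; no)
open import Relation.Nullary.Decidable using (toSum)
open import Relation.Unary using (_∩_; Satisfiable; Empty; ∅)

Touching : {X Y : Set} → (X → Y → Set) → (X → Set) → (Y → Set) → Set
Touching R A B = ∃₂ λ a b → A a × B b × R a b

module _ {V : Set} where

  private
    variable
      R : V → V → Set
      a b c w : V
      xs ys zs : List V
      S A B C D : V → Set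

  data Walk (R : V → V → Set) : V → V → List V → Set where
    stop : Walk R a a [ a ]
    _◅_  : R a b → Walk R b c xs → Walk R a c (a ∷ xs)

  infixr 5 _◅_ _◅◅_

  _◅◅_ : Walk R a b xs → Walk R b c ys → Walk R a c (xs ++ drop 1 ys)
  stop ◅◅ stop = stop
  stop ◅◅ (r ◅ q) = r ◅ q
  (r ◅ p) ◅◅ q = r ◅ (p ◅◅ q)

  walk-head : Walk R a b xs → a ∈ xs
  walk-head stop = here refl
  walk-head (_ ◅ _) = here refl

  walk-last : Walk R a b xs → b ∈ xs
  walk-last stop = here refl
  walk-last (_ ◅ p) = there (walk-last p)

  walk-reverse : Symmetric R → Walk R a b xs → Walk R b a (reverse xs)
  walk-reverse sym stop = stop
  walk-reverse {R = R} sym (_◅_ {a = a} {xs = xs} r p) =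
    subst (Walk R _ a) (≡.sym (unfold-reverse a xs)) (walk-reverse sym p ◅◅ (sym r ◅ stop))

  walk-suffix : ∀ α {β} → Walk R a b (α ++ w ∷ β) → Walk R w b (w ∷ β)
  walk-suffix [] stop = stop
  walk-suffix [] (r ◅ p) = r ◅ p
  walk-suffix (_ ∷ []) (_ ◅ p) = walk-suffix [] p
  walk-suffix (_ ∷ y ∷ α) (_ ◅ p) = walk-suffix (y ∷ α) p

  walk-graft : ∀ α {β} → Walk R a b (α ++ w ∷ β) → Walk R w c (w ∷ ys) →
               Walk R a c (α ++ w ∷ ys)
  walk-graft [] stop q = q
  walk-graft [] (_ ◅ _) q = q
  walk-graft (_ ∷ []) (r ◅ p) q = r ◅ walk-graft [] p q
  walk-graft (_ ∷ y ∷ α) (r ◅ p) q = r ◅ walk-graft (y ∷ α) p q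

  walk-ends : Walk R a b xs → ∃ λ ys → xs ≡ ys ∷ʳ b
  walk-ends stop = [] , refl
  walk-ends (_◅_ {a = a} _ p) with walk-ends p
  ... | ys , refl = a ∷ ys , refl

  walk⇒linked : Walk R a b xs → Linked R xs
  walk⇒linked stop = [-]
  walk⇒linked (r ◅ stop) = r ∷ [-]
  walk⇒linked (r ◅ p@(_ ◅ _)) = r ∷ walk⇒linked p

  walk-length≥2 : Walk R a b xs → a ≢ b → 2 ≤ length xs
  walk-length≥2 stop a≢b = ⊥-elim (a≢b refl)
  walk-length≥2 (_ ◅ stop) _ = s≤s (s≤s z≤n)
  walk-length≥2 (_ ◅ _ ◅ _) _ = s≤s (s≤s z≤n)

  linked⇒walk : Linked R (a ∷ xs) → a ∷ xs ≡ ys ∷ʳ b → Walk R a b (a ∷ xs)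
  linked⇒walk {ys = []} [-] refl = stop
  linked⇒walk {ys = _ ∷ []} [-] ()
  linked⇒walk {ys = _ ∷ _ ∷ _} [-] ()
  linked⇒walk {ys = y ∷ ys} (r ∷ l) eq = r ◅ linked⇒walk l (∷-injectiveʳ eq)

  path⇒walk : {G : Graph V} → IsPath G a b xs → Walk (Adj G) a b xs
  path⇒walk P with IsPath.starts P | IsPath.ends P
  ... | _ , refl | _ , eq = linked⇒walk (IsPath.linked P) eq

  Unique-++⁻ˡ : ∀ xs → Unique (xs ++ ys) → Unique xs
  Unique-++⁻ˡ [] _ = []
  Unique-++⁻ˡ (x ∷ xs) (x∉ ∷ u) = All.++⁻ˡ xs x∉ ∷ Unique-++⁻ˡ xs u

  Unique-++⁻ʳ : ∀ xs → Unique (xs ++ ys) → Unique ys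
  Unique-++⁻ʳ [] u = u
  Unique-++⁻ʳ (x ∷ xs) (_ ∷ u) = Unique-++⁻ʳ xs u

  Unique-⊆-length : Unique xs → xs ⊆ ys → length xs ≤ length ys
  Unique-⊆-length {xs = []} _ _ = z≤n
  Unique-⊆-length {xs = x ∷ xs} (x∉xs ∷ uxs) xs⊆ys with ∈-∃++ (xs⊆ys (here refl))
  ... | ρ , σ , refl = begin
    suc (length xs)          ≤⟨ s≤s (Unique-⊆-length uxs xs⊆ρσ) ⟩
    suc (length (ρ ++ σ))    ≡⟨ cong suc (length-++ ρ) ⟩
    suc (length ρ + length σ) ≡⟨ +-suc (length ρ) (length σ) ⟨
    length ρ + length (x ∷ σ) ≡⟨ length-++ ρ ⟨
    length (ρ ++ x ∷ σ)      ∎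
    where
    open ≤-Reasoning
    xs⊆ρσ : xs ⊆ ρ ++ σ
    xs⊆ρσ z∈xs with ∈-++⁻ ρ (xs⊆ys (there z∈xs))
    ... | inj₁ z∈ρ = ∈-++⁺ˡ z∈ρ
    ... | inj₂ (here refl) = ⊥-elim (All.lookup x∉xs z∈xs refl)
    ... | inj₂ (there z∈σ) = ∈-++⁺ʳ ρ z∈σ

  WalkIn : (V → V → Set) → (V → Set) → V → V → Set
  WalkIn R S a b = ∃ λ xs → Walk R a b xs × All S xs

  PathIn : (V → V → Set) → (V → Set) → V → V → Set
  PathIn R S a b = ∃ λ xs → Walk R a b xs × Unique xs × All S xs

  ConnectedSet : (V → V → Set) → (V → Set) → Set
  ConnectedSet R S = ∀ {a b} → S a → S b → WalkIn R S a b

  walkIn-trans : WalkIn R S a b → WalkIn R S b c → WalkIn R S a c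
  walkIn-trans (_ , p , Sp) (_ , q , Sq) = _ , p ◅◅ q , All.++⁺ Sp (All.drop⁺ 1 Sq)

  walkIn-sym : Symmetric R → WalkIn R S a b → WalkIn R S b a
  walkIn-sym sym (_ , p , Sp) = _ , walk-reverse sym p , All.anti-mono Any.reverse⁻ Sp

  walkIn-edge : S a → S b → R a b → WalkIn R S a b
  walkIn-edge Sa Sb r = _ , r ◅ stop , Sa ∷ Sb ∷ []

  crossing-edge : (∀ v → A v ⊎ S v ⊎ B v) → Empty (A ∩ B) →
                  Walk R a b xs → All (λ v → ¬ S v) xs → A a → B b → Touching R A B
  crossing-edge split A∩B-empty stop _ Aa Bb = ⊥-elim (A∩B-empty _ (Aa , Bb))
  crossing-edge split A∩B-empty (_◅_ {b = v} r p) (_ ∷ ¬Sp) Aa Bb with split v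
  ... | inj₁ Av = crossing-edge split A∩B-empty p ¬Sp Av Bb
  ... | inj₂ (inj₁ Sv) = ⊥-elim (All.lookup ¬Sp (walk-head p) Sv)
  ... | inj₂ (inj₂ Bv) = _ , _ , Aa , Bv , r

  separated-if-no-edge : {G : Graph V} → (∀ v → A v ⊎ S v ⊎ B v) → Empty (A ∩ B) →
                         ¬ Touching (Adj G) A B → Separates G S A B
  separated-if-no-edge split A∩B-empty no-edge _ _ _ Aa Bb path ¬S =
    no-edge (crossing-edge split A∩B-empty (path⇒walk path) ¬S Aa Bb)

  module _ (_≟_ : DecidableEquality V) where
    open import Data.List.Membership.DecPropositional _≟_ using (_∈?_)

    walk-shortcut : Walk R a b xs → ∃ λ ys → Walk R a b ys × Unique ys × ys ⊆ xs
    walk-shortcut stop = _ , stop , [] ∷ [] , λ z∈ → z∈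
    walk-shortcut (_◅_ {a = a} r p) with walk-shortcut p
    ... | ys , q , uq , q⊆p with a ∈? ys
    ...   | no a∉ys = a ∷ ys , r ◅ q , All.¬Any⇒All¬ ys a∉ys ∷ uq , ∷⁺ʳ a q⊆p
    ...   | yes a∈ys with ∈-∃++ a∈ys
    ...     | ρ , σ , refl =
      a ∷ σ , walk-suffix ρ q , Unique-++⁻ʳ ρ uq , λ z∈ → there (q⊆p (∈-++⁺ʳ ρ z∈))

    -- Cut the first path at its first vertex w on the second one and continue along the
    -- second from w; the two pieces share only w.
    path-splice : Walk R a b xs → Unique xs → Walk R b c ys → Unique ys →
                  ∃₂ λ w zs → Walk R a c zs × Unique zs × w ∈ zs × w ∈ xs × w ∈ ys
    path-splice {xs = xs} {ys = ys} p up q uq with First.first (λ z → Sum.swap (toSum (z ∈? ys))) xs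
    ... | inj₂ xs∉ys = ⊥-elim (All.lookup xs∉ys (walk-last p) (walk-head q))
    ... | inj₁ hit with toView hit
    ...   | First._++_∷_ {xs = α} {y = w} α∉ys w∈ys β with ∈-∃++ w∈ys
    ...     | ρ , γ , refl =
      w , α ++ w ∷ γ , walk-graft α p (walk-suffix ρ q) ,
      Unique.++⁺ (Unique-++⁻ˡ α up) (Unique-++⁻ʳ ρ uq)
        (λ (v∈α , v∈wγ) → All.lookup α∉ys v∈α (∈-++⁺ʳ ρ v∈wγ)) ,
      ∈-++⁺ʳ α (here refl) , ∈-++⁺ʳ α (here refl) , w∈ys

    walkIn⇒pathIn : WalkIn R S a b → PathIn R S a b
    walkIn⇒pathIn (_ , p , Sp) with walk-shortcut p
    ... | ys , q , uq , q⊆p = ys , q , uq , All.anti-mono q⊆p Sp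

    module _ {G : Graph V} (acyclic : Acyclic G) where

      no-cycle-closing : Walk (Adj G) a b zs → Unique zs → a ≢ b → All (c ≢_) zs →
                         Adj G c a → Adj G b c → ⊥
      no-cycle-closing {b = b} {zs = zs} {c = c} p uzs a≢b c∉zs ca bc with walk-ends p
      ... | ys , zs≡ys∷ʳb = acyclic (c ∷ zs) record
        { distinct = c∉zs ∷ uzs
        ; linked   = walk⇒linked (ca ◅ p)
        ; long     = s≤s (walk-length≥2 p a≢b)
        ; closes   = c , b , ys , cong (c ∷_) zs≡ys∷ʳb , bc
        }

      paths-unique : Walk (Adj G) a b xs → Unique xs → Walk (Adj G) a b ys → Unique ys → xs ≡ ys
      paths-unique stop _ stop _ = refl
      paths-unique stop _ (_ ◅ q) (a∉q ∷ _) = ⊥-elim (All.lookup a∉q (walk-last q) refl)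
      paths-unique (_ ◅ p) (a∉p ∷ _) stop _ = ⊥-elim (All.lookup a∉p (walk-last p) refl)
      paths-unique (_◅_ {b = u} r p) (a∉p ∷ up) (_◅_ {b = v} s q) (a∉q ∷ uq) with u ≟ v
      ... | yes refl = cong (_ ∷_) (paths-unique p up q uq)
      ... | no u≢v
        with walkIn⇒pathIn (walkIn-trans (_ , p , a∉p) (walkIn-sym (Graph.sym G) (_ , q , a∉q)))
      ...   | _ , u⋯v , unique , a∉u⋯v =
        ⊥-elim (no-cycle-closing u⋯v unique u≢v a∉u⋯v r (Graph.sym G s))

      ∩-connected : ConnectedSet (Adj G) A → ConnectedSet (Adj G) B → ConnectedSet (Adj G) (A ∩ B)
      ∩-connected A-conn B-conn (aA , aB) (bA , bB)
        with walkIn⇒pathIn (A-conn aA bA) | walkIn⇒pathIn (B-conn aB bB)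
      ... | _ , p , up , pA | _ , q , uq , qB with paths-unique p up q uq
      ...   | refl = _ , p , All.zip (pA , qB)

      helly₃ : ConnectedSet (Adj G) A → ConnectedSet (Adj G) B → ConnectedSet (Adj G) C →
               (A ∩ B) a → (B ∩ C) b → (A ∩ C) c → Satisfiable (A ∩ B ∩ C)
      helly₃ A-conn B-conn C-conn (aA , aB) (bB , bC) (cA , cC)
        with walkIn⇒pathIn (B-conn aB bB) | walkIn⇒pathIn (C-conn bC cC) | walkIn⇒pathIn (A-conn aA cA)
      ... | _ , p , up , pB | _ , q , uq , qC | _ , r , ur , rA with path-splice p up q uq
      ...   | w , _ , s , us , w∈s , w∈p , w∈q with paths-unique s us r ur
      ...     | refl = w , All.lookup rA w∈s , All.lookup pB w∈p , All.lookup qC w∈q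

      helly₄ : ConnectedSet (Adj G) A → ConnectedSet (Adj G) B →
               ConnectedSet (Adj G) C → ConnectedSet (Adj G) D →
               Satisfiable (A ∩ B) → Satisfiable (A ∩ C) → Satisfiable (A ∩ D) →
               Satisfiable (B ∩ C) → Satisfiable (B ∩ D) → Satisfiable (C ∩ D) →
               Satisfiable (A ∩ B ∩ C ∩ D)
      helly₄ A-conn B-conn C-conn D-conn (_ , AB) (_ , AC) (_ , AD) (_ , BC) (_ , Bx , Dx) (_ , Cy , Dy)
        with helly₃ A-conn D-conn B-conn AD (Dx , Bx) AB | helly₃ A-conn D-conn C-conn AD (Dy , Cy) AC
      ... | _ , A₁ , D₁ , B₁ | _ , A₂ , D₂ , C₂
        with helly₃ (∩-connected A-conn D-conn) B-conn C-conn ((A₁ , D₁) , B₁) BC ((A₂ , D₂) , C₂)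
      ...   | w , (Aw , Dw) , Bw , Cw = w , Aw , Bw , Cw , Dw

walk-map : {V W : Set} {R : V → V → Set} {R′ : W → W → Set} {a b : V} {xs : List V} (f : V → W) →
           (∀ {u v} → R u v → R′ (f u) (f v)) → Walk R a b xs → Walk R′ (f a) (f b) (map f xs)
walk-map f f-hom stop = stop
walk-map f f-hom (r ◅ p) = f-hom r ◅ walk-map f f-hom p

walkIn-map : {V W : Set} {R : W → W → Set} {S : W → Set} {a b : V} (f : V → W) →
             WalkIn (R on f) (S ∘ f) a b → WalkIn R S (f a) (f b)
walkIn-map f (_ , p , Sp) = _ , walk-map f (λ r → r) p , All.map⁺ Sp

module _ {V : Set} {H : Graph V} {k : ℕ} (D : TreeDecomposition H k) where
  open TreeDecomposition D

  private
    variable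
      Z A B : V → Set
      u v : V
      s s′ : Fin t
      xs : List V

  BagsMeeting : (V → Set) → Fin t → Set
  BagsMeeting Z s = ∃ λ v → Z v × v ∈ bag s

  vertex-bags-connected : Z v → v ∈ bag s → v ∈ bag s′ → WalkIn (Adj T) (BagsMeeting Z) s s′
  vertex-bags-connected {v = v} Zv v∈s v∈s′ with subtreeConnected v _ _ v∈s v∈s′
  ... | _ , path , v∈path = _ , path⇒walk path , All.map (λ v∈ → v , Zv , v∈) v∈path

  lift-walk : Walk (Adj H) u v xs → All Z xs → u ∈ bag s → v ∈ bag s′ →
              WalkIn (Adj T) (BagsMeeting Z) s s′
  lift-walk stop (Zu ∷ []) u∈s u∈s′ = vertex-bags-connected Zu u∈s u∈s′
  lift-walk (_◅_ {a = u} {b = w} r p) (Zu ∷ Zp) u∈s v∈s′ with edgeCovered u w r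
  ... | s″ , u∈s″ , w∈s″ =
    walkIn-trans (vertex-bags-connected Zu u∈s u∈s″) (lift-walk p Zp w∈s″ v∈s′)

  bagsMeeting-connected : ConnectedSet (Adj H) Z → ConnectedSet (Adj T) (BagsMeeting Z)
  bagsMeeting-connected Z-conn (u , Zu , u∈s) (v , Zv , v∈s′) with Z-conn Zu Zv
  ... | _ , p , Zp = lift-walk p Zp u∈s v∈s′

  touching⇒shared-bag : Touching (Adj H) A B → Satisfiable (BagsMeeting A ∩ BagsMeeting B)
  touching⇒shared-bag (u , v , Au , Bv , uv) with edgeCovered u v uv
  ... | s , u∈s , v∈s = s , (u , Au , u∈s) , (v , Bv , v∈s)

record K₄Minor {V : Set} (H : Graph V) : Set₁ where
  field
    B₁ B₂ B₃ B₄ : V → Set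
    connected₁ : ConnectedSet (Adj H) B₁
    connected₂ : ConnectedSet (Adj H) B₂
    connected₃ : ConnectedSet (Adj H) B₃
    connected₄ : ConnectedSet (Adj H) B₄
    touching₁₂ : Touching (Adj H) B₁ B₂
    touching₁₃ : Touching (Adj H) B₁ B₃
    touching₁₄ : Touching (Adj H) B₁ B₄
    touching₂₃ : Touching (Adj H) B₂ B₃
    touching₂₄ : Touching (Adj H) B₂ B₄
    touching₃₄ : Touching (Adj H) B₃ B₄
    disjoint₁₂ : Empty (B₁ ∩ B₂)
    disjoint₁₃ : Empty (B₁ ∩ B₃)
    disjoint₁₄ : Empty (B₁ ∩ B₄)
    disjoint₂₃ : Empty (B₂ ∩ B₃)
    disjoint₂₄ : Empty (B₂ ∩ B₄)
    disjoint₃₄ : Empty (B₃ ∩ B₄)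

disjoint⇒≢ : {V : Set} {A B : V → Set} {u v : V} → Empty (A ∩ B) → A u → B v → u ≢ v
disjoint⇒≢ A∩B-empty Au Bv refl = A∩B-empty _ (Au , Bv)

module _ {V : Set} {H : Graph V} (D : TreeDecomposition H 2) where
  open TreeDecomposition D

  no-K₄-minor : ¬ K₄Minor H
  no-K₄-minor M = bag-overfull shared-bag
    where
    open K₄Minor M
    MeetsAll : Fin t → Set
    MeetsAll = BagsMeeting D B₁ ∩ BagsMeeting D B₂ ∩ BagsMeeting D B₃ ∩ BagsMeeting D B₄
    shared-bag : Satisfiable MeetsAll
    shared-bag = helly₄ Fin._≟_ (IsTree.acyclic isTree)
      (bagsMeeting-connected D connected₁) (bagsMeeting-connected D connected₂)
      (bagsMeeting-connected D connected₃) (bagsMeeting-connected D connected₄)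
      (touching⇒shared-bag D touching₁₂) (touching⇒shared-bag D touching₁₃)
      (touching⇒shared-bag D touching₁₄) (touching⇒shared-bag D touching₂₃)
      (touching⇒shared-bag D touching₂₄) (touching⇒shared-bag D touching₃₄)
    bag-overfull : Satisfiable MeetsAll → ⊥
    bag-overfull (s , (v₁ , B₁v₁ , v₁∈s) , (v₂ , B₂v₂ , v₂∈s) ,
                      (v₃ , B₃v₃ , v₃∈s) , (v₄ , B₄v₄ , v₄∈s)) =
      <-irrefl refl (≤-trans (Unique-⊆-length distinct ⊆bag) (bagSize s))
      where
      distinct : Unique (v₁ ∷ v₂ ∷ v₃ ∷ v₄ ∷ [])
      distinct = ( disjoint⇒≢ disjoint₁₂ B₁v₁ B₂v₂
                 ∷ disjoint⇒≢ disjoint₁₃ B₁v₁ B₃v₃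
                 ∷ disjoint⇒≢ disjoint₁₄ B₁v₁ B₄v₄ ∷ [])
               ∷ (disjoint⇒≢ disjoint₂₃ B₂v₂ B₃v₃ ∷ disjoint⇒≢ disjoint₂₄ B₂v₂ B₄v₄ ∷ [])
               ∷ (disjoint⇒≢ disjoint₃₄ B₃v₃ B₄v₄ ∷ [])
               ∷ [] ∷ []
      ⊆bag : (v₁ ∷ v₂ ∷ v₃ ∷ v₄ ∷ []) ⊆ bag s
      ⊆bag (here refl) = v₁∈s
      ⊆bag (there (here refl)) = v₂∈s
      ⊆bag (there (there (here refl))) = v₃∈s
      ⊆bag (there (there (there (here refl)))) = v₄∈s

Segment : {k : ℕ} → ℕ → ℕ → Fin k → Set
Segment lo hi i = lo ≤ toℕ i × toℕ i < hi

segments-disjoint : {k lo hi lo′ hi′ : ℕ} → hi ≤ lo′ → Empty (Segment {k} lo hi ∩ Segment lo′ hi′)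
segments-disjoint hi≤lo′ _ ((_ , i<hi) , (lo′≤i , _)) =
  <-irrefl refl (<-≤-trans i<hi (≤-trans hi≤lo′ lo′≤i))

module _ {m : ℕ} {R : Fin (suc m) → Fin (suc m) → Set} (sym : Symmetric R)
         (consecutive : ∀ i j → suc (toℕ i) ≡ toℕ j → R i j) where

  climb : ∀ d {lo hi i j} → toℕ j ≡ d + toℕ i → Segment lo hi i → Segment lo hi j →
          WalkIn R (Segment lo hi) i j
  climb zero j≡i Si _ with toℕ-injective j≡i
  ... | refl = _ , stop , Si ∷ []
  climb (suc d) {j = zero} ()
  climb (suc d) {lo} {hi} {i} {suc j} j≡d+i Si Sj =
    walkIn-trans (climb d j′≡d+i Si Sj′)
                 (walkIn-edge Sj′ Sj (consecutive _ _ (cong suc (toℕ-inject₁ j))))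
    where
    j′≡d+i : toℕ (inject₁ j) ≡ d + toℕ i
    j′≡d+i = ≡.trans (toℕ-inject₁ j) (suc-injective j≡d+i)
    Sj′ : Segment lo hi (inject₁ j)
    Sj′ = ≤-trans (proj₁ Si) (subst (toℕ i ≤_) (≡.sym j′≡d+i) (m≤n+m (toℕ i) d)) ,
          <-trans (s≤s (≤-reflexive (toℕ-inject₁ j))) (proj₂ Sj)

  segment-connected : ∀ {lo hi} → ConnectedSet R (Segment lo hi)
  segment-connected {a = a} {b} Sa Sb with ≤-total (toℕ a) (toℕ b)
  ... | inj₁ a≤b = climb _ (≡.sym (m∸n+n≡m a≤b)) Sa Sb
  ... | inj₂ b≤a = walkIn-sym sym (climb _ (≡.sym (m∸n+n≡m b≤a)) Sb Sa)

module _ {X Y : Set} {H : Graph (X ⊎ Y)} where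

  left-connected : {A : X → Set} → ConnectedSet (Adj H on inj₁) A → ConnectedSet (Adj H) [ A , ∅ ]′
  left-connected A-conn {inj₁ _} {inj₁ _} Aa Ab = walkIn-map inj₁ (A-conn Aa Ab)

  right-connected : {B : Y → Set} → ConnectedSet (Adj H on inj₂) B → ConnectedSet (Adj H) [ ∅ , B ]′
  right-connected B-conn {inj₂ _} {inj₂ _} Ba Bb = walkIn-map inj₂ (B-conn Ba Bb)

[,]-disjoint : {X Y : Set} {A A′ : X → Set} {B B′ : Y → Set} →
               Empty (A ∩ A′) → Empty (B ∩ B′) → Empty ([ A , B ]′ ∩ [ A′ , B′ ]′)
[,]-disjoint A∩A′-empty _ (inj₁ x) = A∩A′-empty x
[,]-disjoint _ B∩B′-empty (inj₂ y) = B∩B′-empty y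

left-right-disjoint : {X Y : Set} {A : X → Set} {B : Y → Set} → Empty ([ A , ∅ ]′ ∩ [ ∅ , B ]′)
left-right-disjoint (inj₁ _) (_ , ())
left-right-disjoint (inj₂ _) (() , _)

module _ {N k : ℕ} {G : Graph (Fin N)} {p : Fin k → Fin N} (p-path : IsInducedPath G p) where

  path-consecutive-adjacent : ∀ i j → suc (toℕ i) ≡ toℕ j → Adj G (p i) (p j)
  path-consecutive-adjacent i j i+1≡j = proj₂ (proj₂ p-path i j) (inj₁ i+1≡j)

  path-nonadjacent-across : ∀ {x y c} → toℕ x < c → c < toℕ y → ¬ Adj G (p x) (p y)
  path-nonadjacent-across {x} {y} {c} x<c c<y xy with proj₁ (proj₂ p-path x y) xy
  ... | inj₁ x+1≡y = <⇒≱ x<c (s≤s⁻¹ (subst (suc c ≤_) (≡.sym x+1≡y) c<y))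
  ... | inj₂ y+1≡x = <⇒≱ (<-trans x<c c<y) (subst (toℕ y ≤_) y+1≡x (n≤1+n (toℕ y)))

module _ {N m n : ℕ} {G : Graph (Fin N)} {p : Fin (suc m) → Fin N} {q : Fin (suc n) → Fin N}
         (p-path : IsInducedPath G p) (q-path : IsInducedPath G q) where

  private
    H = AugmentedPQ G p q

    p-step : ∀ i j → suc (toℕ i) ≡ toℕ j → Adj G (p i) (p j)
    p-step = path-consecutive-adjacent {G = G} p-path

    q-step : ∀ i j → suc (toℕ i) ≡ toℕ j → Adj G (q i) (q j)
    q-step = path-consecutive-adjacent {G = G} q-path

  crossing-chords⇒K₄ : ∀ {s₁ s₂ r₁ r₂} → toℕ s₁ < toℕ s₂ → toℕ r₁ < toℕ r₂ →
                       Adj G (p s₁) (q r₂) → Adj G (p s₂) (q r₁) → K₄Minor H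
  crossing-chords⇒K₄ {s₂ = zero} ()
  crossing-chords⇒K₄ {r₂ = zero} _ ()
  crossing-chords⇒K₄ {s₁} {suc s₂′} {r₁} {suc r₂′} s₁<s₂ r₁<r₂ chord₁ chord₂ = record
    { B₁ = [ Segment 0 (suc (toℕ s₂′)) , ∅ ]′
    ; B₂ = [ Segment (suc (toℕ s₂′)) (suc m) , ∅ ]′
    ; B₃ = [ ∅ , Segment 0 (suc (toℕ r₂′)) ]′
    ; B₄ = [ ∅ , Segment (suc (toℕ r₂′)) (suc n) ]′
    ; connected₁ = P-segment-connected 0 (suc (toℕ s₂′))
    ; connected₂ = P-segment-connected (suc (toℕ s₂′)) (suc m)
    ; connected₃ = Q-segment-connected 0 (suc (toℕ r₂′))
    ; connected₄ = Q-segment-connected (suc (toℕ r₂′)) (suc n)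
    ; touching₁₂ = inj₁ (inject₁ s₂′) , inj₁ (suc s₂′) , last-below s₂′ , (≤-refl , toℕ<n _) ,
                   inj₁ (p-step _ _ (cong suc (toℕ-inject₁ s₂′)))
    ; touching₁₃ = inj₁ zero , inj₂ zero , (z≤n , s≤s z≤n) , (z≤n , s≤s z≤n) ,
                   inj₂ (inj₁ (refl , refl))
    ; touching₁₄ = inj₁ s₁ , inj₂ (suc r₂′) , (z≤n , s₁<s₂) , (≤-refl , toℕ<n _) , inj₁ chord₁
    ; touching₂₃ = inj₁ (suc s₂′) , inj₂ r₁ , (≤-refl , toℕ<n _) , (z≤n , r₁<r₂) , inj₁ chord₂
    ; touching₂₄ = inj₁ (fromℕ m) , inj₂ (fromℕ n) , (≤fromℕ _ , toℕ<n _) , (≤fromℕ _ , toℕ<n _) ,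
                   inj₂ (inj₂ (inj₂ (inj₁ (refl , refl))))
    ; touching₃₄ = inj₂ (inject₁ r₂′) , inj₂ (suc r₂′) , last-below r₂′ , (≤-refl , toℕ<n _) ,
                   inj₁ (q-step _ _ (cong suc (toℕ-inject₁ r₂′)))
    ; disjoint₁₂ = [,]-disjoint (segments-disjoint ≤-refl) (λ { _ (() , _) })
    ; disjoint₁₃ = left-right-disjoint
    ; disjoint₁₄ = left-right-disjoint
    ; disjoint₂₃ = left-right-disjoint
    ; disjoint₂₄ = left-right-disjoint
    ; disjoint₃₄ = [,]-disjoint (λ { _ (() , _) }) (segments-disjoint ≤-refl)
    }
    where
    P-segment-connected : ∀ lo hi → ConnectedSet (Adj H) [ Segment lo hi , ∅ ]′
    P-segment-connected lo hi = left-connected {H = H} {A = Segment lo hi}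
      (segment-connected (Graph.sym H) (λ i j e → inj₁ (p-step i j e)))
    Q-segment-connected : ∀ lo hi → ConnectedSet (Adj H) [ ∅ , Segment lo hi ]′
    Q-segment-connected lo hi = right-connected {H = H} {B = Segment lo hi}
      (segment-connected (Graph.sym H) (λ i j e → inj₁ (q-step i j e)))
    last-below : ∀ {k} (s : Fin k) → Segment 0 (suc (toℕ s)) (inject₁ s)
    last-below s = z≤n , s≤s (≤-reflexive (toℕ-inject₁ s))

before-sep-after : {m n : ℕ} (i : Fin m) (j : Fin n) → ∀ v → Before i j v ⊎ SepSet i j v ⊎ After i j v
before-sep-after i j (inj₁ k) with Fin.<-cmp k i
... | tri< k<i _ _ = inj₁ k<i
... | tri≈ _ refl _ = inj₂ (inj₁ (inj₁ refl))
... | tri> _ _ i<k = inj₂ (inj₂ i<k)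
before-sep-after i j (inj₂ k) with Fin.<-cmp k j
... | tri< k<j _ _ = inj₁ k<j
... | tri≈ _ refl _ = inj₂ (inj₁ (inj₂ refl))
... | tri> _ _ j<k = inj₂ (inj₂ j<k)

before-after-disjoint : {m n : ℕ} (i : Fin m) (j : Fin n) → Empty (Before i j ∩ After i j)
before-after-disjoint i j (inj₁ _) (k<i , i<k) = <-asym k<i i<k
before-after-disjoint i j (inj₂ _) (k<j , j<k) = <-asym k<j j<k

lemma6p10 : (N m n : ℕ) (G : Graph (Fin N))
    (p : Fin (suc m) → Fin N) (q : Fin (suc n) → Fin N) →
    IsInducedPath G p → IsInducedPath G q →
    (∀ i j → p i ≢ q j) →
    TreewidthAtMost (AugmentedPQ G p q) 2 →
    ∀ (i : Fin (suc m)) (j : Fin (suc n)) → Adj G (p i) (q j) →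
    Separates (InducedPQ G p q) (SepSet i j) (Before i j) (After i j)
lemma6p10 N m n G p q p-path q-path _ D i j pᵢqⱼ =
  separated-if-no-edge {G = InducedPQ G p q} (before-sep-after i j) (before-after-disjoint i j) no-edge-across
  where
  no-edge-across : ¬ Touching (Adj (InducedPQ G p q)) (Before i j) (After i j)
  no-edge-across (inj₁ x , inj₁ y , x<i , i<y , pₓp_y) =
    path-nonadjacent-across {G = G} p-path x<i i<y pₓp_y
  no-edge-across (inj₂ x , inj₂ y , x<j , j<y , qₓq_y) =
    path-nonadjacent-across {G = G} q-path x<j j<y qₓq_y
  no-edge-across (inj₁ x , inj₂ y , x<i , j<y , pₓq_y) =
    no-K₄-minor D (crossing-chords⇒K₄ p-path q-path x<i j<y pₓq_y pᵢqⱼ)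
  no-edge-across (inj₂ x , inj₁ y , x<j , i<y , qₓp_y) =
    no-K₄-minor D (crossing-chords⇒K₄ p-path q-path i<y x<j pᵢqⱼ (Graph.sym G qₓp_y))
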